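{- Let $K_5^-$ be the graph on five vertices $A_2,A_3,A_{14},B_{14},C_{14}$ in which every pair of distinct vertices is adjacent except the pair $B_{14},C_{14}$. Consider the hat guessing game on $K_5^-$ in which $A_2$ has hatness $2$, $A_3$ has hatness $3$, and each of $A_{14},B_{14},C_{14}$ has hatness $14$. Then this game is winning.
   Context: Hat guessing game with hatness function: a sage sits at each vertex $v$ of a graph and receives a hat of one of $h(v)$ colors (the hatness of $v$); each sage sees only the hat colors of adjacent sages and guesses his own color via a deterministic strategy agreed in advance without communication. The game is winning if there is a strategy guaranteeing that for every hat assignment at least one sage guesses correctly. -}

module Defs where

open import Data.Nat using (ℕ)
open import Data.Fin using (Fin; zero; suc)
open import Data.Product using (Σ; ∃)
open import Data.Empty using (⊥)
open import Data.Unit using (⊤)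
open import Relation.Nullary using (¬_)
open import Relation.Binary.PropositionalEquality using (_≡_)

record Graph (n : ℕ) : Set₁ where
  field
    Adj       : Fin n → Fin n → Set
    irreflAdj : ∀ v → ¬ Adj v v
    symAdj    : ∀ u v → Adj u v → Adj v u
open Graph public

Coloring : ∀ {n} → (Fin n → ℕ) → Set
Coloring {n} h = (v : Fin n) → Fin (h v)

View : ∀ {n} → Graph n → (Fin n → ℕ) → Fin n → Set
View {n} G h v = (u : Fin n) → Adj G v u → Fin (h u)

Strategy : ∀ {n} → Graph n → (Fin n → ℕ) → Set
Strategy {n} G h = (v : Fin n) → View G h v → Fin (h v)

view : ∀ {n} (G : Graph n) (h : Fin n → ℕ) → Coloring h → (v : Fin n) → View G h v
view G h c v u _ = c u

Winning : ∀ {n} → Graph n → (Fin n → ℕ) → Set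
Winning G h = Σ (Strategy G h) λ s → (c : Coloring h) → ∃ λ v → s v (view G h c v) ≡ c v

-- K5^- : vertices 0=A2, 1=A3, 2=A14, 3=B14, 4=C14; all distinct pairs
-- adjacent except {B14, C14} = {3, 4}.
K5⁻Adj : Fin 5 → Fin 5 → Set
K5⁻Adj zero zero = ⊥
K5⁻Adj zero (suc zero) = ⊤
K5⁻Adj zero (suc (suc zero)) = ⊤
K5⁻Adj zero (suc (suc (suc zero))) = ⊤
K5⁻Adj zero (suc (suc (suc (suc zero)))) = ⊤
K5⁻Adj (suc zero) zero = ⊤
K5⁻Adj (suc zero) (suc zero) = ⊥
K5⁻Adj (suc zero) (suc (suc zero)) = ⊤
K5⁻Adj (suc zero) (suc (suc (suc zero))) = ⊤
K5⁻Adj (suc zero) (suc (suc (suc (suc zero)))) = ⊤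
K5⁻Adj (suc (suc zero)) zero = ⊤
K5⁻Adj (suc (suc zero)) (suc zero) = ⊤
K5⁻Adj (suc (suc zero)) (suc (suc zero)) = ⊥
K5⁻Adj (suc (suc zero)) (suc (suc (suc zero))) = ⊤
K5⁻Adj (suc (suc zero)) (suc (suc (suc (suc zero)))) = ⊤
K5⁻Adj (suc (suc (suc zero))) zero = ⊤
K5⁻Adj (suc (suc (suc zero))) (suc zero) = ⊤
K5⁻Adj (suc (suc (suc zero))) (suc (suc zero)) = ⊤
K5⁻Adj (suc (suc (suc zero))) (suc (suc (suc zero))) = ⊥
K5⁻Adj (suc (suc (suc zero))) (suc (suc (suc (suc zero)))) = ⊥
K5⁻Adj (suc (suc (suc (suc zero)))) zero = ⊤
K5⁻Adj (suc (suc (suc (suc zero)))) (suc zero) = ⊤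
K5⁻Adj (suc (suc (suc (suc zero)))) (suc (suc zero)) = ⊤
K5⁻Adj (suc (suc (suc (suc zero)))) (suc (suc (suc zero))) = ⊥
K5⁻Adj (suc (suc (suc (suc zero)))) (suc (suc (suc (suc zero)))) = ⊥

K5⁻-irrefl : ∀ v → ¬ K5⁻Adj v v
K5⁻-irrefl zero ()
K5⁻-irrefl (suc zero) ()
K5⁻-irrefl (suc (suc zero)) ()
K5⁻-irrefl (suc (suc (suc zero))) ()
K5⁻-irrefl (suc (suc (suc (suc zero)))) ()

K5⁻-sym : ∀ u v → K5⁻Adj u v → K5⁻Adj v u
K5⁻-sym zero zero ()
K5⁻-sym zero (suc zero) a = a
K5⁻-sym zero (suc (suc zero)) a = a
K5⁻-sym zero (suc (suc (suc zero))) a = a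
K5⁻-sym zero (suc (suc (suc (suc zero)))) a = a
K5⁻-sym (suc zero) zero a = a
K5⁻-sym (suc zero) (suc zero) ()
K5⁻-sym (suc zero) (suc (suc zero)) a = a
K5⁻-sym (suc zero) (suc (suc (suc zero))) a = a
K5⁻-sym (suc zero) (suc (suc (suc (suc zero)))) a = a
K5⁻-sym (suc (suc zero)) zero a = a
K5⁻-sym (suc (suc zero)) (suc zero) a = a
K5⁻-sym (suc (suc zero)) (suc (suc zero)) ()
K5⁻-sym (suc (suc zero)) (suc (suc (suc zero))) a = a
K5⁻-sym (suc (suc zero)) (suc (suc (suc (suc zero)))) a = a
K5⁻-sym (suc (suc (suc zero))) zero a = a
K5⁻-sym (suc (suc (suc zero))) (suc zero) a = a
K5⁻-sym (suc (suc (suc zero))) (suc (suc zero)) a = a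
K5⁻-sym (suc (suc (suc zero))) (suc (suc (suc zero))) ()
K5⁻-sym (suc (suc (suc zero))) (suc (suc (suc (suc zero)))) ()
K5⁻-sym (suc (suc (suc (suc zero)))) zero a = a
K5⁻-sym (suc (suc (suc (suc zero)))) (suc zero) a = a
K5⁻-sym (suc (suc (suc (suc zero)))) (suc (suc zero)) a = a
K5⁻-sym (suc (suc (suc (suc zero)))) (suc (suc (suc zero))) ()
K5⁻-sym (suc (suc (suc (suc zero)))) (suc (suc (suc (suc zero)))) ()

K5⁻ : Graph 5
K5⁻ = record { Adj = K5⁻Adj ; irreflAdj = K5⁻-irrefl ; symAdj = K5⁻-sym }

hatness : Fin 5 → ℕ
hatness zero = 2
hatness (suc zero) = 3
hatness (suc (suc _)) = 14

-- A₂ and A₃ see everybody else, and on their own edge they can arrange to lose on a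
-- single prescribed configuration (x₂ , x₃), read as an index k < 6. So it suffices
-- that, whatever the colours a, b, c of A₁₄, B₁₄, C₁₄, some k makes one of these three
-- right when they are told k. B₁₄ and C₁₄ guess a − k and a − dₖ (mod 14), with
-- d = (0, 1, 2, 7, 8, 9); for fixed b, c these catch the colours a ∈ (b + {0..5}) ∪ (c + d).
-- As {0..5} meets each translate of d in at most 3 points, fewer than 6 colours escape,
-- and A₁₄ guesses the k-th of them.
module Submission where

open import Defs
open import Data.Nat using (ℕ; suc; _∸_; _+_; _≤_; _≤?_)
open import Data.Nat.DivMod using (_mod_)
open import Data.Fin using (Fin; zero; suc; toℕ; inject≤; punchIn; combine; remQuot; _≟_)
open import Data.Fin.Properties using (all?; any?; toℕ-inject≤; combine-remQuot)
open import Data.Bool using (if_then_else_)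
open import Data.List using (List; _∷_; length; lookup; head; drop; filter; allFin)
open import Data.List.Membership.Propositional using (_∈_)
open import Data.List.Membership.Propositional.Properties using (∈-filter⁺; ∈-allFin)
open import Data.List.Relation.Unary.Any using (index)
open import Data.List.Relation.Unary.Any.Properties using (lookup-index)
open import Data.Maybe using (just; fromMaybe)
open import Data.Vec as Vec using ()
open import Data.Product using (∃; _×_; _,_; proj₁; proj₂; uncurry)
open import Data.Product.Properties using (≡-dec)
open import Data.Sum using (_⊎_; inj₁; inj₂)
open import Data.Unit using (tt)
open import Relation.Nullary using (¬_; yes; no; does; ¬?; _×-dec_)
open import Relation.Nullary.Decidable using (from-yes; _⊎-dec_)
open import Relation.Unary using (Decidable)
open import Relation.Binary.PropositionalEquality using (_≡_; refl; sym; trans; cong; module ≡-Reasoning)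

head-drop-lookup : ∀ {A : Set} (xs : List A) (i : Fin (length xs)) →
                   head (drop (toℕ i) xs) ≡ just (lookup xs i)
head-drop-lookup (x ∷ xs) zero    = refl
head-drop-lookup (x ∷ xs) (suc i) = head-drop-lookup xs i

∈⇒∃-head-drop : ∀ {A : Set} {n} {x : A} {xs : List A} → length xs ≤ n → x ∈ xs →
                ∃ λ (k : Fin n) → head (drop (toℕ k) xs) ≡ just x
∈⇒∃-head-drop {x = x} {xs} len≤n x∈xs = inject≤ i len≤n , (begin
  head (drop (toℕ (inject≤ i len≤n)) xs) ≡⟨ cong (λ m → head (drop m xs)) (toℕ-inject≤ i len≤n) ⟩
  head (drop (toℕ i) xs)                 ≡⟨ head-drop-lookup xs i ⟩
  just (lookup xs i)                     ≡⟨ cong just (sym (lookup-index x∈xs)) ⟩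
  just x                                 ∎)
  where
  open ≡-Reasoning
  i : Fin (length xs)
  i = index x∈xs

-- With s₀ , s₁ the two colours other than t₃: A₂ is right at (¬t₂ , t₃), (¬t₂ , s₀), (t₂ , s₁)
-- and A₃ at (t₂ , s₀), (¬t₂ , s₁).
guess₂ : Fin 2 × Fin 3 → Fin 3 → Fin 2
guess₂ (t₂ , t₃) x₃ = if does (x₃ ≟ punchIn t₃ (suc zero)) then t₂ else punchIn t₂ zero

guess₃ : Fin 2 × Fin 3 → Fin 2 → Fin 3
guess₃ (t₂ , t₃) x₂ = if does (x₂ ≟ t₂) then punchIn t₃ zero else punchIn t₃ (suc zero)

edge-loses-only-at : ∀ t x₂ x₃ → guess₂ t x₃ ≡ x₂ ⊎ guess₃ t x₂ ≡ x₃ ⊎ (x₂ , x₃) ≡ t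
edge-loses-only-at (t₂ , t₃) = decided t₂ t₃
  where
  decided : ∀ t₂ t₃ x₂ x₃ →
            guess₂ (t₂ , t₃) x₃ ≡ x₂ ⊎ guess₃ (t₂ , t₃) x₂ ≡ x₃ ⊎ (x₂ , x₃) ≡ (t₂ , t₃)
  decided = from-yes (all? λ t₂ → all? λ t₃ → all? λ x₂ → all? λ x₃ →
    guess₂ (t₂ , t₃) x₃ ≟ x₂ ⊎-dec guess₃ (t₂ , t₃) x₂ ≟ x₃ ⊎-dec ≡-dec _≟_ _≟_ (x₂ , x₃) (t₂ , t₃))

-- Subtraction of m modulo n + 1; only meaningful for m ≤ n + 1.
_⊖_ : ∀ {n} → Fin (suc n) → ℕ → Fin (suc n)
_⊖_ {n} a m = (toℕ a + (suc n ∸ m)) mod suc n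

offsetB : Fin 6 → ℕ
offsetB = toℕ

offsetC : Fin 6 → ℕ
offsetC = Vec.lookup (0 Vec.∷ 1 Vec.∷ 2 Vec.∷ 7 Vec.∷ 8 Vec.∷ 9 Vec.∷ Vec.[])

Uncovered : Fin 14 → Fin 14 → Fin 14 → Set
Uncovered b c a = ¬ (∃ λ k → a ⊖ offsetB k ≡ b) × ¬ (∃ λ k → a ⊖ offsetC k ≡ c)

uncovered? : ∀ b c → Decidable (Uncovered b c)
uncovered? b c a = ¬? (any? λ k → a ⊖ offsetB k ≟ b) ×-dec ¬? (any? λ k → a ⊖ offsetC k ≟ c)

uncovered : Fin 14 → Fin 14 → List (Fin 14)
uncovered b c = filter (uncovered? b c) (allFin 14)

few-uncovered : ∀ b c → length (uncovered b c) ≤ 6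
few-uncovered = from-yes (all? λ b → all? λ c → length (uncovered b c) ≤? 6)

guess₁₄ : Fin 14 → Fin 14 → Fin 6 → Fin 14
guess₁₄ b c k = fromMaybe zero (head (drop (toℕ k) (uncovered b c)))

Caught : Fin 14 → Fin 14 → Fin 14 → Fin 6 → Set
Caught b c a k = a ⊖ offsetB k ≡ b ⊎ a ⊖ offsetC k ≡ c ⊎ guess₁₄ b c k ≡ a

caught : ∀ b c a → ∃ (Caught b c a)
caught b c a with any? (λ k → a ⊖ offsetB k ≟ b) | any? (λ k → a ⊖ offsetC k ≟ c)
... | yes (k , rightB) | _                = k , inj₁ rightB
... | no _             | yes (k , rightC) = k , inj₂ (inj₁ rightC)
... | no missB         | no missC         =
  let k , listed = ∈⇒∃-head-drop (few-uncovered b c)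
                     (∈-filter⁺ (uncovered? b c) (∈-allFin a) (missB , missC))
  in  k , inj₂ (inj₂ (cong (fromMaybe zero) listed))

pattern A₂  = zero
pattern A₃  = suc zero
pattern A₁₄ = suc (suc zero)
pattern B₁₄ = suc (suc (suc zero))
pattern C₁₄ = suc (suc (suc (suc zero)))

catchIndex : Fin 14 → Fin 14 → Fin 14 → Fin 6
catchIndex a b c = proj₁ (caught b c a)

target : Fin 14 → Fin 14 → Fin 14 → Fin 2 × Fin 3
target a b c = remQuot 3 (catchIndex a b c)

strategy : Strategy K5⁻ hatness
strategy A₂  w = guess₂ (target (w A₁₄ tt) (w B₁₄ tt) (w C₁₄ tt)) (w A₃ tt)
strategy A₃  w = guess₃ (target (w A₁₄ tt) (w B₁₄ tt) (w C₁₄ tt)) (w A₂ tt)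
strategy A₁₄ w = guess₁₄ (w B₁₄ tt) (w C₁₄ tt) (combine (w A₂ tt) (w A₃ tt))
strategy B₁₄ w = w A₁₄ tt ⊖ offsetB (combine (w A₂ tt) (w A₃ tt))
strategy C₁₄ w = w A₁₄ tt ⊖ offsetC (combine (w A₂ tt) (w A₃ tt))

path-wins : ∀ (x : Coloring hatness) k → combine (x A₂) (x A₃) ≡ k →
            Caught (x B₁₄) (x C₁₄) (x A₁₄) k →
            ∃ λ v → strategy v (view K5⁻ hatness x v) ≡ x v
path-wins x k refl (inj₁ rightB)        = B₁₄ , rightB
path-wins x k refl (inj₂ (inj₁ rightC)) = C₁₄ , rightC
path-wins x k refl (inj₂ (inj₂ rightA)) = A₁₄ , rightA

someone-right : ∀ (x : Coloring hatness) → ∃ λ v → strategy v (view K5⁻ hatness x v) ≡ x v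
someone-right x with edge-loses-only-at (target (x A₁₄) (x B₁₄) (x C₁₄)) (x A₂) (x A₃)
... | inj₁ right₂        = A₂ , right₂
... | inj₂ (inj₁ right₃) = A₃ , right₃
... | inj₂ (inj₂ hit)    =
  path-wins x k (trans (cong (uncurry combine) hit) (combine-remQuot {2} 3 k))
                (proj₂ (caught (x B₁₄) (x C₁₄) (x A₁₄)))
  where
  k : Fin 6
  k = catchIndex (x A₁₄) (x B₁₄) (x C₁₄)

lemma3 : Winning K5⁻ hatness
lemma3 = strategy , someone-right
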